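{- Let $G$ be an abelian group, let $G_0 \subseteq G \setminus \{0\}$ be nonempty and let $H = \mathcal{B}_{\pm}(G_0)$. For each $A \in \mathcal{A}(H)$ we have $\{2, |A|\} \subseteq \mathsf{L}(A^2)$. If $\Delta(H) \neq \emptyset$, then $\min \Delta(H)$ divides $|A| - 2$ for every $A \in \mathcal{A}(H)$, and \[\min \Delta(H) \mid \gcd\{|A| - 2 \colon A \in \mathcal{A}(H)\} = \gcd\{|A| - |A'| \colon A, A' \in \mathcal{A}(H)\}.\]
   Context: For a subset $G_0$ of an abelian group $G$, a sequence over $G_0$ is a finite unordered list $S = g_1\cdots g_\ell$ of elements of $G_0$ (repetitions allowed), forming the free commutative monoid over $G_0$ under concatenation; $|S|=\ell$. $S$ is a plus-minus weighted zero-sum sequence if $\sum_i \epsilon_i g_i = 0$ for some $\epsilon_i\in\{+1,-1\}$; $\mathcal{B}_{\pm}(G_0)$ is the monoid of these. For a monoid $H$ with trivial unit group: an atom is a non-identity element not a product of two non-identity elements, and $\mathcal{A}(H)$ is the set of atoms; $\mathsf{L}(a)=\mathsf{L}_H(a)$ is the set of $k$ such that $a$ is a product of $k$ atoms; for finite $L=\{a_0<\dots<a_k\}$, $\Delta(L)=\{a_i-a_{i-1}\}$; $\Delta(H)=\bigcup_{a\in H}\Delta(\mathsf{L}_H(a))$. -}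

module Defs where

open import Level using (Level; _⊔_)
open import Algebra.Bundles using (AbelianGroup)
open import Data.Bool using (Bool; true; false)
open import Data.Nat using (ℕ; suc; _+_; _<_; _≤_)
open import Data.Integer as ℤ using (ℤ; +_)
open import Data.Integer.Divisibility as ℤd using ()
open import Data.List using (List; []; _∷_; _++_; length; concat)
open import Data.List.Relation.Unary.All using (All)
open import Data.Vec using (Vec; []; _∷_)
open import Data.Product using (Σ; ∃; _×_; _,_)
open import Relation.Nullary using (¬_)
open import Relation.Unary using (Pred)
open import Relation.Binary.PropositionalEquality using (_≡_; _≢_)
import Data.List.Relation.Binary.Permutation.Setoid as PermS

-- Sets of integers (for gcd's of possibly infinite sets)
-- g is "the" gcd of the set P ⊆ ℤ : g ≥ 0 divides every element of P, and
-- every common divisor of P divides g.  (ℤ-divisibility is on absolute values.)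
IsGCD : ∀ {p} → (ℤ → Set p) → ℕ → Set p
IsGCD P g = (∀ x → P x → (+ g) ℤd.∣ x) × (∀ c → (∀ x → P x → c ℤd.∣ x) → c ℤd.∣ (+ g))

module PlusMinus {c ℓ p} (G : AbelianGroup c ℓ) (G₀ : Pred (AbelianGroup.Carrier G) p) where
  open AbelianGroup G
  open PermS setoid using (_↭_)

  -- Sequences over G are lists, considered up to (setoid) permutation _↭_.
  -- Weighted sum with signs ε_i ∈ {+1,-1} (true = +1, false = -1).
  signedSum : (S : List Carrier) → Vec Bool (length S) → Carrier
  signedSum [] [] = ε
  signedSum (g ∷ S) (true ∷ es) = g ∙ signedSum S es
  signedSum (g ∷ S) (false ∷ es) = (g ⁻¹) ∙ signedSum S es

  InH : List Carrier → Set (c ⊔ ℓ ⊔ p)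
  InH S = All G₀ S × Σ (Vec Bool (length S)) (λ es → signedSum S es ≈ ε)

  -- atoms of H (identity of H is the empty sequence)
  IsAtom : List Carrier → Set (c ⊔ ℓ ⊔ p)
  IsAtom A = InH A × A ≢ [] × ¬ (Σ (List Carrier) λ B → Σ (List Carrier) λ C →
                 InH B × InH C × B ≢ [] × C ≢ [] × (A ↭ (B ++ C)))

  InL : List Carrier → ℕ → Set (c ⊔ ℓ ⊔ p)
  InL S k = Σ (List (List Carrier)) λ As → length As ≡ k × All IsAtom As × (concat As ↭ S)

  InΔ : ℕ → Set (c ⊔ ℓ ⊔ p)
  InΔ d = Σ (List Carrier) λ S → InH S × Σ ℕ λ k →
            1 ≤ d × InL S k × InL S (k + d) ×
            (∀ j → k < j → j < k + d → ¬ InL S j)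

  IsMinΔ : ℕ → Set (c ⊔ ℓ ⊔ p)
  IsMinΔ d = InΔ d × (∀ d' → InΔ d' → d ≤ d')

  AtomLenMinus2 : ℤ → Set (c ⊔ ℓ ⊔ p)
  AtomLenMinus2 x = Σ (List Carrier) λ A → IsAtom A × (x ≡ ((+ length A) ℤ.- (+ 2)))

  AtomLenDiff : ℤ → Set (c ⊔ ℓ ⊔ p)
  AtomLenDiff x = Σ (List Carrier) λ A → Σ (List Carrier) λ A' → IsAtom A × IsAtom A' ×
                    (x ≡ ((+ length A) ℤ.- (+ length A')))

-- A sequence g g with g ∈ G₀ is an atom (g ≠ 0 rules out a one-element zero-sum
-- subsequence), and A² factors both as A · A and as the |A| atoms g g for g ∈ A;
-- hence 2, |A| ∈ 𝖫(A²). For d = min Δ(H), every element of Δ(H) is a multiple of d: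
-- otherwise write e = q d + r with 0 < r < d and combine sequences witnessing d and e
-- into S^q T, which has two lengths r apart and therefore a gap of size at most r < d.
-- Consecutive lengths of any S ∈ H thus differ by multiples of d, so d ∣ |A| − 2.
module Submission where

open import Defs
open import Algebra.Bundles using (AbelianGroup)
open import Data.Nat using (ℕ)
open import Data.Integer using (+_; _-_)
open import Data.Integer.Divisibility using (_∣_)
open import Data.List using (length; _++_)
open import Data.Product using (Σ; ∃; _×_)
open import Relation.Nullary using (¬_)
open import Relation.Unary using (Pred)
open import Relation.Binary using (_Respects_)
open import Function.Bundles using (_⇔_)

open import Data.Bool using (Bool; true; false)
open import Data.Empty using (⊥-elim)
open import Data.Integer using (ℤ; ∣_∣)
import Data.Integer.Properties as ℤₚ
import Data.Integer.Divisibility.Signed as ℤˢ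
import Data.Integer.Tactic.RingSolver as ℤ-Solver
open import Data.List using (List; []; _∷_; concat; map)
open import Data.List.Properties using (length-++; concat-++; length-map; ++-identityʳ)
open import Data.List.Relation.Unary.All as All using (All; []; _∷_)
import Data.List.Relation.Unary.All.Properties as All
import Data.List.Relation.Binary.Permutation.Setoid as Permutation
import Data.List.Relation.Binary.Permutation.Setoid.Properties as Permutationₚ
open import Data.Nat using (suc; _+_; _*_; _∸_; _≤_; _<_; z≤n; s≤s; >-nonZero)
open import Data.Nat.Divisibility using (_∣?_; _∣0; ∣m∣n⇒∣m+n; m%n≡0⇒n∣m)
  renaming (_∣_ to _∣ₙ_)
open import Data.Nat.DivMod using (_%_; _/_; m≡m%n+[m/n]*n; m%n<n)
open import Data.Nat.Induction using (<-wellFounded)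
open import Data.Nat.Properties
open import Data.Nat.Tactic.RingSolver using (solve-∀)
open import Data.Product using (_,_; proj₁)
open import Data.Sum using (inj₁; inj₂)
open import Data.Vec using (Vec; []; _∷_)
open import Function.Bundles using (Equivalence; mk⇔)
open import Induction.WellFounded using (Acc; acc)
open import Relation.Nullary using (yes; no)
open import Relation.Nullary.Decidable using (decidable-stable; ¬¬-excluded-middle)
open import Relation.Binary.PropositionalEquality
  using (_≡_; _≢_; refl; sym; trans; cong; cong₂; subst)

∣[+m]-[+n]∣≡n∸m : ∀ {m n} → m ≤ n → ∣ + m - + n ∣ ≡ n ∸ m
∣[+m]-[+n]∣≡n∸m {m} {n} m≤n = trans (cong ∣_∣ (ℤₚ.[+m]-[+n]≡m⊖n m n)) (ℤₚ.∣⊖∣-≤ m≤n)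

module _ {p} (P : ℕ → Set p) where

  IsNextGap : ℕ → ℕ → Set p
  IsNextGap x g = 1 ≤ g × P (x + g) × (∀ j → x < j → j < x + g → ¬ P j)

module _ {p} {P : ℕ → Set p} where

  ¬¬-nextGap : ∀ {x r} → P (x + r) → 1 ≤ r → ¬ ¬ (∃ λ g → g ≤ r × IsNextGap P x g)
  ¬¬-nextGap {x} {r} = go r (<-wellFounded r)
    where
    go : ∀ r → Acc _<_ r → P (x + r) → 1 ≤ r → ¬ ¬ (∃ λ g → g ≤ r × IsNextGap P x g)
    go r (acc smaller) px+r 1≤r noGap =
      ¬¬-excluded-middle {A = ∃ λ j → x < j × j < x + r × P j} λ where
      (yes (j , x<j , j<x+r , pj)) →
        let x≤j = <⇒≤ x<j
            j∸x<r = subst (j ∸ x <_) (m+n∸m≡n x r) (∸-monoˡ-< j<x+r x≤j)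
        in go (j ∸ x) (smaller j∸x<r) (subst P (sym (m+[n∸m]≡n x≤j)) pj) (m<n⇒0<n∸m x<j)
              λ (g , g≤j∸x , gap) → noGap (g , ≤-trans g≤j∸x (<⇒≤ j∸x<r) , gap)
      (no noneBetween) →
        noGap (r , ≤-refl , 1≤r , px+r , λ j x<j j<x+r pj → noneBetween (j , x<j , j<x+r , pj))

  -- A divisibility statement is decidable, so it may be proved under ¬ ¬.
  nextGaps∣⇒differences∣ : ∀ {d} → (∀ {y g} → P y → IsNextGap P y g → d ∣ₙ g) →
                           ∀ {x m} → P x → P (x + m) → d ∣ₙ m
  nextGaps∣⇒differences∣ {d} gap∣ {m = m} = go m (<-wellFounded m)
    where
    go : ∀ {x} m → Acc _<_ m → P x → P (x + m) → d ∣ₙ m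
    go 0 _ _ _ = d ∣0
    go {x} m@(suc _) (acc smaller) px px+m = decidable-stable (d ∣? m) λ d∤m →
      ¬¬-nextGap px+m (s≤s z≤n) λ (g , g≤m , gap@(1≤g , px+g , _)) →
        let rest = go (m ∸ g) (smaller (∸-monoʳ-< 1≤g g≤m))
                      px+g (subst P (sym (x+g+[m∸g]≡x+m g≤m)) px+m)
        in d∤m (subst (d ∣ₙ_) (m+[n∸m]≡n g≤m) (∣m∣n⇒∣m+n (gap∣ px gap) rest))
      where
      x+g+[m∸g]≡x+m : ∀ {g} → g ≤ m → x + g + (m ∸ g) ≡ x + m
      x+g+[m∸g]≡x+m {g} g≤m = trans (+-assoc x g (m ∸ g)) (cong (λ k → x + k) (m+[n∸m]≡n g≤m))

  nextGaps∣⇒differences∣ℤ : ∀ {d} → (∀ {y g} → P y → IsNextGap P y g → d ∣ₙ g) →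
                            ∀ {m n} → P m → P n → + d ∣ + m - + n
  nextGaps∣⇒differences∣ℤ {d} gap∣ {m} {n} pm pn with ≤-total m n
  ... | inj₁ m≤n = subst (d ∣ₙ_) (sym (∣[+m]-[+n]∣≡n∸m m≤n))
                     (nextGaps∣⇒differences∣ gap∣ pm (subst P (sym (m+[n∸m]≡n m≤n)) pn))
  ... | inj₂ n≤m = subst (d ∣ₙ_) (sym (trans (ℤₚ.∣i-j∣≡∣j-i∣ (+ m) (+ n)) (∣[+m]-[+n]∣≡n∸m n≤m)))
                     (nextGaps∣⇒differences∣ gap∣ pn (subst P (sym (m+[n∸m]≡n n≤m)) pm))

CommonDivisor : ∀ {q} → (ℤ → Set q) → ℤ → Set q
CommonDivisor X c = ∀ x → X x → c ∣ x

IsGCD-cong : ∀ {q r} {X : ℤ → Set q} {Y : ℤ → Set r} →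
             (∀ c → CommonDivisor X c ⇔ CommonDivisor Y c) → ∀ g → IsGCD X g ⇔ IsGCD Y g
IsGCD-cong same g = mk⇔
  (λ (g∣X , greatest) → to (same (+ g)) g∣X , λ c c∣Y → greatest c (from (same c) c∣Y))
  (λ (g∣Y , greatest) → from (same (+ g)) g∣Y , λ c c∣X → greatest c (to (same c) c∣X))
  where open Equivalence

module _ {c ℓ p} (G : AbelianGroup c ℓ) (G₀ : Pred (AbelianGroup.Carrier G) p) where
  open AbelianGroup G using (Carrier; _≈_; _∙_; ε; _⁻¹; setoid; identityˡ; identityʳ;
    assoc; ∙-cong; ∙-congˡ; inverseʳ) renaming (refl to ≈-refl; sym to ≈-sym; trans to ≈-trans)
  open PlusMinus G G₀
  open Permutation setoid using (_↭_; ↭-refl; ↭-trans; ↭-reflexive; ↭-prep; ↭-sym)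
  open Permutationₚ setoid using (++⁺; ↭-shift; xs↭ys⇒|xs|≡|ys|)

  appendSigns : ∀ (S T : List Carrier) →
                Vec Bool (length S) → Vec Bool (length T) → Vec Bool (length (S ++ T))
  appendSigns []      T []       fs = fs
  appendSigns (_ ∷ S) T (e ∷ es) fs = e ∷ appendSigns S T es fs

  signedSum-++ : ∀ (S T : List Carrier) es fs →
                 signedSum (S ++ T) (appendSigns S T es fs) ≈ signedSum S es ∙ signedSum T fs
  signedSum-++ []      T []           fs = ≈-sym (identityˡ _)
  signedSum-++ (_ ∷ S) T (true  ∷ es) fs = ≈-trans (∙-congˡ (signedSum-++ S T es fs)) (≈-sym (assoc _ _ _))
  signedSum-++ (_ ∷ S) T (false ∷ es) fs = ≈-trans (∙-congˡ (signedSum-++ S T es fs)) (≈-sym (assoc _ _ _))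

  InH-++ : ∀ {S T} → InH S → InH T → InH (S ++ T)
  InH-++ {S} {T} (S⊆G₀ , es , S≈0) (T⊆G₀ , fs , T≈0) =
    All.++⁺ S⊆G₀ T⊆G₀ , appendSigns S T es fs ,
    ≈-trans (signedSum-++ S T es fs) (≈-trans (∙-cong S≈0 T≈0) (identityˡ ε))

  InL-++ : ∀ {S T k l} → InL S k → InL T l → InL (S ++ T) (k + l)
  InL-++ (As , |As|≡k , atomsA , As↭S) (Bs , |Bs|≡l , atomsB , Bs↭T) =
    As ++ Bs , trans (length-++ As) (cong₂ _+_ |As|≡k |Bs|≡l) , All.++⁺ atomsA atomsB ,
    ↭-trans (↭-reflexive (sym (concat-++ As Bs))) (++⁺ As↭S Bs↭T)

  power : ℕ → List Carrier → List Carrier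
  power 0       S = []
  power (suc q) S = S ++ power q S

  InH-power : ∀ q {S} → InH S → InH (power q S)
  InH-power 0       _  = [] , [] , ≈-refl
  InH-power (suc q) hS = InH-++ hS (InH-power q hS)

  InL-power : ∀ q {S k} → InL S k → InL (power q S) (q * k)
  InL-power 0       _  = [] , refl , [] , ↭-refl
  InL-power (suc q) Lk = InL-++ Lk (InL-power q Lk)

  nextGap⇒InΔ : ∀ {S x g} → InH S → InL S x → IsNextGap (InL S) x g → InΔ g
  nextGap⇒InΔ {S} {x} hS Lx (1≤g , Lx+g , noneBetween) = S , hS , x , 1≤g , Lx , Lx+g , noneBetween

  minΔ∣Δ : ∀ {d e} → IsMinΔ d → InΔ e → d ∣ₙ e
  minΔ∣Δ {d} {e} ((Sa , hSa , l , 1≤d , Ll , Ll+d , _) , minimal) (Sb , hSb , k , _ , Lk , Lk+e , _) =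
    decidable-stable (d ∣? e) λ d∤e →
      ¬¬-nextGap Lx+r (1≤r d∤e) λ (g , g≤r , gap) →
        <⇒≱ (m%n<n e d) (≤-trans (minimal g (nextGap⇒InΔ hC Lx gap)) g≤r)
    where
    instance
      _ = >-nonZero 1≤d
    q = e / d
    r = e % d
    1≤r : ¬ d ∣ₙ e → 1 ≤ r
    1≤r d∤e = n≢0⇒n>0 λ r≡0 → d∤e (m%n≡0⇒n∣m e d r≡0)
    C = power q Sa ++ Sb
    hC = InH-++ (InH-power q hSa) hSb
    x = q * (l + d) + k
    Lx : InL C x
    Lx = InL-++ (InL-power q Ll+d) Lk
    -- Sa^q Sb has the lengths q (l + d) + k and q l + (k + e), which differ by e − q d = r.
    x+r≡ : q * l + (k + e) ≡ x + r
    x+r≡ = trans (cong (λ t → q * l + (k + t)) (m≡m%n+[m/n]*n e d)) (regroup q l d k r)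
      where
      regroup : ∀ q l d k r → q * l + (k + (r + q * d)) ≡ q * (l + d) + k + r
      regroup = solve-∀
    Lx+r : InL C (x + r)
    Lx+r = subst (InL C) x+r≡ (InL-++ (InL-power q Ll) Lk+e)

  minΔ∣lengthDifference : ∀ {d S m n} → IsMinΔ d → InH S → InL S m → InL S n → + d ∣ + m - + n
  minΔ∣lengthDifference minΔ hS =
    nextGaps∣⇒differences∣ℤ λ Ly gap → minΔ∣Δ minΔ (nextGap⇒InΔ hS Ly gap)

  pair : Carrier → List Carrier
  pair g = g ∷ g ∷ []

  InH-pair : ∀ {g} → G₀ g → InH (pair g)
  InH-pair {g} g∈G₀ = g∈G₀ ∷ g∈G₀ ∷ [] , true ∷ false ∷ [] , ≈-trans (∙-congˡ (identityʳ _)) (inverseʳ g)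

  concat-map-pair↭ : ∀ A → concat (map pair A) ↭ A ++ A
  concat-map-pair↭ []      = ↭-refl
  concat-map-pair↭ (g ∷ A) = ↭-prep g (↭-trans (↭-prep g (concat-map-pair↭ A)) (↭-sym (↭-shift A A)))

  length≡2⇒singleton : ∀ (B C : List Carrier) → B ≢ [] → C ≢ [] →
                       2 ≡ length (B ++ C) → ∃ λ g → B ≡ g ∷ []
  length≡2⇒singleton []          _       B≢[] _    _  = ⊥-elim (B≢[] refl)
  length≡2⇒singleton (g ∷ [])    _       _    _    _  = g , refl
  length≡2⇒singleton (_ ∷ _ ∷ _) []      _    C≢[] _  = ⊥-elim (C≢[] refl)
  length≡2⇒singleton (_ ∷ _ ∷ B) (_ ∷ C) _    _    eq =
    ⊥-elim (m+1+n≢0 (length B) (sym (trans (suc-injective (suc-injective eq)) (length-++ B))))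

  module _ (0∉G₀ : ∀ g → G₀ g → ¬ g ≈ ε) where

    singleton∉H : ∀ {g} → ¬ InH (g ∷ [])
    singleton∉H {g} (g∈G₀ ∷ [] , true ∷ [] , g∙ε≈ε) = 0∉G₀ g g∈G₀ (≈-trans (≈-sym (identityʳ g)) g∙ε≈ε)
    singleton∉H {g} (g∈G₀ ∷ [] , false ∷ [] , g⁻¹∙ε≈ε) =
      0∉G₀ g g∈G₀ (≈-trans (≈-sym (identityʳ g)) (≈-trans (∙-congˡ (≈-sym g⁻¹≈ε)) (inverseʳ g)))
      where g⁻¹≈ε = ≈-trans (≈-sym (identityʳ (g ⁻¹))) g⁻¹∙ε≈ε

    pair-isAtom : ∀ {g} → G₀ g → IsAtom (pair g)
    pair-isAtom g∈G₀ = InH-pair g∈G₀ , (λ ()) , λ (B , C , hB , _ , B≢[] , C≢[] , pair↭BC) →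
      let (_ , B≡[g]) = length≡2⇒singleton B C B≢[] C≢[] (xs↭ys⇒|xs|≡|ys| pair↭BC)
      in singleton∉H (subst InH B≡[g] hB)

    InL-square : ∀ A → IsAtom A → InL (A ++ A) 2 × InL (A ++ A) (length A)
    InL-square A atom@((A⊆G₀ , _) , _) =
      (A ∷ A ∷ [] , refl , atom ∷ atom ∷ [] , ↭-reflexive (cong (A ++_) (++-identityʳ A))) ,
      (map pair A , length-map pair A , All.map⁺ (All.map pair-isAtom A⊆G₀) , concat-map-pair↭ A)

    minΔ-commonDivisor : ∀ {d} → IsMinΔ d → CommonDivisor AtomLenMinus2 (+ d)
    minΔ-commonDivisor minΔ _ (A , atom , refl) =
      let (L2 , L|A|) = InL-square A atom in
      minΔ∣lengthDifference minΔ (InH-++ (proj₁ atom) (proj₁ atom)) L|A| L2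

    commonDivisor-atomLengths : ∀ {g} → G₀ g → ∀ c →
      CommonDivisor AtomLenMinus2 c ⇔ CommonDivisor AtomLenDiff c
    commonDivisor-atomLengths g∈G₀ c = mk⇔
      (λ c∣A-2 → λ { _ (A , A′ , atom , atom′ , refl) →
        ℤˢ.∣⇒∣ᵤ (subst (c ℤˢ.∣_) (regroup (+ length A) (+ length A′))
          (ℤˢ.∣m∣n⇒∣m-n {m = + length A - + 2} {n = + length A′ - + 2}
            (ℤˢ.∣ᵤ⇒∣ (c∣A-2 _ (A , atom , refl))) (ℤˢ.∣ᵤ⇒∣ (c∣A-2 _ (A′ , atom′ , refl))))) })
      (λ c∣A-A′ x (A , atom , x≡) → c∣A-A′ x (A , pair _ , atom , pair-isAtom g∈G₀ , x≡))
      where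
      regroup : ∀ a a′ → (a - + 2) - (a′ - + 2) ≡ a - a′
      regroup = ℤ-Solver.solve-∀

lemma4p2 : ∀ {c ℓ p} (G : AbelianGroup c ℓ) (G₀ : Pred (AbelianGroup.Carrier G) p) →
    G₀ Respects (AbelianGroup._≈_ G) →
    (∀ g → G₀ g → ¬ (AbelianGroup._≈_ G g (AbelianGroup.ε G))) →
    (∃ λ g → G₀ g) →
    let open PlusMinus G G₀ in
    (∀ A → IsAtom A → InL (A ++ A) 2 × InL (A ++ A) (length A)) ×
    ((∃ λ d → InΔ d) → ∀ d → IsMinΔ d →
      (∀ A → IsAtom A → (+ d) ∣ ((+ length A) - (+ 2))) ×
      (∀ g → IsGCD AtomLenMinus2 g → (+ d) ∣ (+ g)) ×
      (∀ g → IsGCD AtomLenMinus2 g ⇔ IsGCD AtomLenDiff g))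
lemma4p2 G G₀ _ 0∉G₀ (_ , g∈G₀) =
  InL-square G G₀ 0∉G₀ , λ _ d minΔ →
    (λ A atom → minΔ-commonDivisor G G₀ 0∉G₀ minΔ _ (A , atom , refl)) ,
    (λ _ (_ , greatest) → greatest (+ d) (minΔ-commonDivisor G G₀ 0∉G₀ minΔ)) ,
    IsGCD-cong (commonDivisor-atomLengths G G₀ 0∉G₀ g∈G₀)
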